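{- Let $p$ be an odd prime and $u\in\mathbb{F}_p[x]$ monic of degree $d$ with $x\nmid u$. Then all entries of $M_u^{d^2+d}$ are positive.
   Context: Let $G_u$ be the directed graph with vertex set $\mathbb{F}_p[x]/(u)$ and an edge from $\alpha$ to $\beta$ whenever $\beta = \alpha x + c$ for some $c\in\mathbb{F}_p\setminus\{0\}$ (loops allowed). $M_u$ is its adjacency matrix: the $(\beta,\alpha)$-entry is $1$ if $\beta = \alpha x + c$ for some nonzero $c\in\mathbb{F}_p$ and $0$ otherwise. -}

module Defs where

open import Data.Nat using (ℕ; zero; suc; _+_; _*_; NonZero)
open import Data.Nat.DivMod using (_mod_)
open import Data.Fin using (Fin; toℕ)
open import Data.Fin.Properties using (_≟_)
open import Data.Vec using (Vec; []; _∷_; _∷ʳ_; last; init; zipWith; map; head)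
open import Data.Vec.Properties using (≡-dec)
open import Data.List using (List; []; _∷_; concatMap; filter; allFin)
open import Data.Nat.ListAction using (sum)
open import Data.Bool.ListAction using (any)
import Data.List as L
open import Data.Bool using (if_then_else_)
open import Relation.Nullary using (¬_; ¬?; Dec; yes; no; does)
open import Relation.Binary.PropositionalEquality using (_≡_)

module _ {p : ℕ} {{_ : NonZero p}} where

  F : Set
  F = Fin p

  0F : F
  0F = 0 mod p

  1F : F
  1F = 1 mod p

  _+F_ : F → F → F
  a +F b = (toℕ a + toℕ b) mod p

  _*F_ : F → F → F
  a *F b = (toℕ a * toℕ b) mod p

  -F_ : F → F
  -F a = ((p Data.Nat.∸ toℕ a)) mod p

  _-F_ : F → F → F
  a -F b = a +F (-F b)

-- A monic polynomial u of degree d over F_p is given by its lower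
-- coefficients (u₀, …, u_{d-1}):  u = x^d + u_{d-1} x^{d-1} + … + u₀.

  Monic : ℕ → Set
  Monic d = Vec F d

  -- constant coefficient u(0) of the monic polynomial u
  -- (for d = 0, u = 1, so u(0) = 1)
  const : ∀ {d} → Monic d → F
  const {zero}  []      = 1F
  const {suc d} (u ∷ _) = u

  XDivides : ∀ {d} → Monic d → Set
  XDivides u = const u ≡ 0F

-- Elements of F_p[x]/(u): unique representatives of degree < d,
-- given by coefficient vectors (a₀, …, a_{d-1}).

  Quot : ℕ → Set
  Quot d = Vec F d

  -- multiplication by x in F_p[x]/(u):
  -- (Σ aᵢ xⁱ)·x = Σ a_{i-1} xⁱ + a_{d-1} x^d,  x^d ≡ -Σ uᵢ xⁱ (mod u)
  mulX : ∀ {d} → Monic d → Quot d → Quot d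
  mulX {zero}  u a = []
  mulX {suc d} u a =
    zipWith (λ s uᵢ → s -F (last a *F uᵢ)) (0F ∷ init a) u

  addC : ∀ {d} → Quot d → F → Quot d
  addC {zero}  []      c = []
  addC {suc d} (a ∷ as) c = (a +F c) ∷ as

  allQuot : (d : ℕ) → List (Quot d)
  allQuot zero    = [] ∷ []
  allQuot (suc d) =
    concatMap (λ a → L.map (a ∷_) (allQuot d)) (allFin p)

  nonzeroF : List F
  nonzeroF = filter (λ c → ¬? (c ≟ 0F)) (allFin p)

  _≟Q_ : ∀ {d} (a b : Quot d) → Dec (a ≡ b)
  _≟Q_ = ≡-dec _≟_

  Mat : ℕ → Set
  Mat d = Quot d → Quot d → ℕ

  M : ∀ {d} → Monic d → Mat d
  M u β α =
    if any (λ c → does (β ≟Q addC (mulX u α) c)) nonzeroF then 1 else 0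

  idMat : ∀ {d} → Mat d
  idMat β α = if does (β ≟Q α) then 1 else 0

  _⊗_ : ∀ {d} → Mat d → Mat d → Mat d
  _⊗_ {d} A B β α = sum (L.map (λ γ → A β γ * B γ α) (allQuot d))

  _^M_ : ∀ {d} → Mat d → ℕ → Mat d
  A ^M zero  = idMat
  A ^M suc k = A ⊗ (A ^M k)

-- A walk of length k from α in G_u that adds the nonzero constants cₖ, …, c₁ (in this order) ends at
-- xᵏ α + c₁ + c₂ x + ⋯ + cₖ xᵏ⁻¹, so M_u^k(β, α) > 0 as soon as β has this form. For k = d(d+1), cut
-- the constants into d+1 blocks of d; each block is a vector of F_p^d without zero coordinates
-- ("nonvanishing"), and with T the multiplication by x^d the reachable points are
--   v₀ + T v₁ + ⋯ + T^d v_d + T^(d+1) α        (all vᵢ nonvanishing).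
-- Since x ∤ u, x is invertible modulo u, so T is an invertible linear map. Put Λᵢ = T⁻ⁱ eᵢ and
-- vᵢ = μᵢ Λᵢ + z(Λᵢ) for 1 ≤ i ≤ d, where z(Λ) is 1 exactly at the zero coordinates of Λ: then vᵢ is
-- nonvanishing whenever μᵢ ≠ 0, and the sum above is v₀ + μ + C with C independent of v₀ and μ.
-- As p > 2, every vector β - C is a sum v₀ + μ of two nonvanishing vectors.

module Submission where

open import Defs
open import Level using (0ℓ)
open import Algebra.Bundles using (AbelianGroup; CommutativeRing)
open import Algebra.Structures using (IsAbelianGroup; IsCommutativeRing)
open import Algebra.Consequences.Propositional using (comm∧idˡ⇒id; comm∧invˡ⇒inv; comm∧distrʳ⇒distrˡ)
import Algebra.Properties.AbelianGroup as AbelianGroupProperties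
import Algebra.Properties.CommutativeSemigroup as CommutativeSemigroupProperties
import Algebra.Properties.Ring as RingProperties
open import Data.Bool using (true; if_then_else_)
open import Data.Bool.Properties using (T-≡)
open import Data.Fin using (toℕ)
open import Data.Fin.Properties using (_≟_; toℕ-fromℕ<; toℕ-injective; toℕ<n)
open import Data.List as List using (List; []; _∷_; _++_; length; foldr)
import Data.List.Properties as List
open import Data.List.Membership.Propositional using (_∈_; lose)
open import Data.List.Membership.Propositional.Properties using (∈-allFin; ∈-concat⁺′; ∈-filter⁺; ∈-map⁺)
open import Data.List.Relation.Unary.All using (All; []; _∷_)
import Data.List.Relation.Unary.All.Properties as All
open import Data.List.Relation.Unary.Any using (here; there)
open import Data.List.Relation.Unary.Any.Properties using (any⁺)
open import Data.Nat using (ℕ; zero; suc; _+_; _*_; _<_; _≤_; _∸_; _%_; z≤n; s≤s)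
open import Data.Nat using (NonZero; nonTrivial⇒n>1; >-nonZero⁻¹; ≢-nonZero)
import Data.Nat.Properties as ℕ
open import Data.Nat.Coprimality using (coprime-Bézout; prime⇒coprime)
open import Data.Nat.DivMod using (_mod_; m<n⇒m%n≡m; n%n≡0; %-distribˡ-+; %-distribˡ-*; [m+kn]%n≡m%n)
open import Data.Nat.Divisibility using (_∣_; ∣-refl)
open import Data.Nat.GCD using (module Bézout)
open import Data.Nat.ListAction using (sum)
open import Data.Nat.Primality using (Prime; prime⇒nonTrivial)
open import Data.Product using (∃; ∃₂; ∃-syntax; _×_; _,_)
open import Data.Vec using (Vec; []; _∷_; _∷ʳ_; init; last; map; replicate; zipWith; toList; concat)
  renaming (_++_ to _++ᵛ_)
import Data.Vec.Properties as Vec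
open import Function using (_∘_)
open import Function.Bundles using (Equivalence)
open import Relation.Binary.PropositionalEquality
open import Relation.Nullary using (¬_; ¬?; yes; no)
open import Relation.Nullary.Decidable using (dec-true)

infixr 8 _^_

_^_ : {A : Set} → (A → A) → ℕ → A → A
(f ^ zero) a  = a
(f ^ suc k) a = f ((f ^ k) a)

^-suc : ∀ {A : Set} (f : A → A) k a → (f ^ suc k) a ≡ (f ^ k) (f a)
^-suc f zero    a = refl
^-suc f (suc k) a = cong f (^-suc f k a)

^-inverseʳ : ∀ {A : Set} {f g : A → A} → (∀ a → f (g a) ≡ a) → ∀ k a → (f ^ k) ((g ^ k) a) ≡ a
^-inverseʳ         f∘g zero    a = refl
^-inverseʳ {f = f} {g} f∘g (suc k) a = begin
  f ((f ^ k) ((g ^ suc k) a))  ≡⟨ cong (f ∘ (f ^ k)) (^-suc g k a) ⟩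
  f ((f ^ k) ((g ^ k) (g a)))  ≡⟨ cong f (^-inverseʳ f∘g k (g a)) ⟩
  f (g a)                      ≡⟨ f∘g a ⟩
  a                            ∎
  where open ≡-Reasoning

module _ {A B C : Set} (f : A → B → C) where

  init-zipWith : ∀ {n} (xs : Vec A (suc n)) ys → init (zipWith f xs ys) ≡ zipWith f (init xs) (init ys)
  init-zipWith {zero}  (x ∷ []) (y ∷ [])  = refl
  init-zipWith {suc n} (x ∷ xs) (y ∷ ys) = cong (f x y ∷_) (init-zipWith xs ys)

  last-zipWith : ∀ {n} (xs : Vec A (suc n)) ys → last (zipWith f xs ys) ≡ f (last xs) (last ys)
  last-zipWith {zero}  (x ∷ []) (y ∷ [])  = refl
  last-zipWith {suc n} (x ∷ xs) (y ∷ ys) = last-zipWith xs ys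

module _ {A B : Set} (f : A → B) where

  init-map : ∀ {n} (xs : Vec A (suc n)) → init (map f xs) ≡ map f (init xs)
  init-map {zero}  (x ∷ [])  = refl
  init-map {suc n} (x ∷ xs) = cong (f x ∷_) (init-map xs)

  last-map : ∀ {n} (xs : Vec A (suc n)) → last (map f xs) ≡ f (last xs)
  last-map {zero}  (x ∷ [])  = refl
  last-map {suc n} (x ∷ xs) = last-map xs

∈⇒≤sum : ∀ {A : Set} (f : A → ℕ) {x xs} → x ∈ xs → f x ≤ sum (List.map f xs)
∈⇒≤sum f (here refl)           = ℕ.m≤m+n _ _
∈⇒≤sum f {xs = y ∷ _} (there x∈xs) = ℕ.≤-trans (∈⇒≤sum f x∈xs) (ℕ.m≤n+m _ (f y))

odd-prime⇒2<p : ∀ {p} → Prime p → ¬ (2 ∣ p) → 2 < p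
odd-prime⇒2<p {p} p-prime p-odd =
  ℕ.≤∧≢⇒< (nonTrivial⇒n>1 p {{prime⇒nonTrivial p-prime}}) (λ 2≡p → p-odd (subst (2 ∣_) 2≡p ∣-refl))

0<if : ∀ {b} → b ≡ true → 0 < (if b then 1 else 0)
0<if refl = s≤s z≤n

All-toList-concat⁺ : ∀ {A : Set} {P : A → Set} {n m} (vs : Vec (Vec A n) m) →
                     All (λ v → All P (toList v)) (toList vs) → All P (toList (concat vs))
All-toList-concat⁺ []       []           = []
All-toList-concat⁺ (v ∷ vs) (Pv ∷ Pvs) =
  subst (All _) (sym (Vec.toList-++ v (concat vs))) (All.++⁺ Pv (All-toList-concat⁺ vs Pvs))

module _ {p : ℕ} {{_ : NonZero p}} where

  -- Arithmetic in F_p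

  toℕ-mod : ∀ m → toℕ (m mod p) ≡ m % p
  toℕ-mod m = toℕ-fromℕ< _

  toℕ-mod-toℕ : (a : F {p}) → toℕ a mod p ≡ a
  toℕ-mod-toℕ a = toℕ-injective (trans (toℕ-mod _) (m<n⇒m%n≡m (toℕ<n a)))

  mod-cong : ∀ {m n} → m % p ≡ n % p → m mod p ≡ n mod p
  mod-cong eq = toℕ-injective (trans (toℕ-mod _) (trans eq (sym (toℕ-mod _))))

  mod-+ : ∀ m n → (m mod p) +F (n mod p) ≡ (m + n) mod p
  mod-+ m n = mod-cong (begin
    (toℕ (m mod p) + toℕ (n mod p)) % p  ≡⟨ cong₂ (λ a b → (a + b) % p) (toℕ-mod m) (toℕ-mod n) ⟩
    (m % p + n % p) % p                  ≡⟨ %-distribˡ-+ m n p ⟨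
    (m + n) % p                          ∎)
    where open ≡-Reasoning

  mod-* : ∀ m n → (m mod p) *F (n mod p) ≡ (m * n) mod p
  mod-* m n = mod-cong (begin
    (toℕ (m mod p) * toℕ (n mod p)) % p  ≡⟨ cong₂ (λ a b → (a * b) % p) (toℕ-mod m) (toℕ-mod n) ⟩
    (m % p * (n % p)) % p                ≡⟨ %-distribˡ-* m n p ⟨
    (m * n) % p                          ∎)
    where open ≡-Reasoning

  +F-comm : ∀ a b → a +F b ≡ b +F a
  +F-comm a b = cong (_mod p) (ℕ.+-comm (toℕ a) (toℕ b))

  *F-comm : ∀ a b → a *F b ≡ b *F a
  *F-comm a b = cong (_mod p) (ℕ.*-comm (toℕ a) (toℕ b))

  +F-assoc : ∀ a b c → (a +F b) +F c ≡ a +F (b +F c)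
  +F-assoc a b c = begin
    (a +F b) +F c                                 ≡⟨ cong ((a +F b) +F_) (toℕ-mod-toℕ c) ⟨
    ((toℕ a + toℕ b) mod p) +F (toℕ c mod p)      ≡⟨ mod-+ _ (toℕ c) ⟩
    (toℕ a + toℕ b + toℕ c) mod p                 ≡⟨ cong (_mod p) (ℕ.+-assoc (toℕ a) _ _) ⟩
    (toℕ a + (toℕ b + toℕ c)) mod p               ≡⟨ mod-+ (toℕ a) _ ⟨
    (toℕ a mod p) +F ((toℕ b + toℕ c) mod p)      ≡⟨ cong (_+F (b +F c)) (toℕ-mod-toℕ a) ⟩
    a +F (b +F c)                                 ∎
    where open ≡-Reasoning

  *F-assoc : ∀ a b c → (a *F b) *F c ≡ a *F (b *F c)
  *F-assoc a b c = begin
    (a *F b) *F c                                 ≡⟨ cong ((a *F b) *F_) (toℕ-mod-toℕ c) ⟨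
    ((toℕ a * toℕ b) mod p) *F (toℕ c mod p)      ≡⟨ mod-* _ (toℕ c) ⟩
    (toℕ a * toℕ b * toℕ c) mod p                 ≡⟨ cong (_mod p) (ℕ.*-assoc (toℕ a) _ _) ⟩
    (toℕ a * (toℕ b * toℕ c)) mod p               ≡⟨ mod-* (toℕ a) _ ⟨
    (toℕ a mod p) *F ((toℕ b * toℕ c) mod p)      ≡⟨ cong (_*F (b *F c)) (toℕ-mod-toℕ a) ⟩
    a *F (b *F c)                                 ∎
    where open ≡-Reasoning

  *F-distribʳ-+F : ∀ c a b → (a +F b) *F c ≡ (a *F c) +F (b *F c)
  *F-distribʳ-+F c a b = begin
    (a +F b) *F c                                 ≡⟨ cong ((a +F b) *F_) (toℕ-mod-toℕ c) ⟨
    ((toℕ a + toℕ b) mod p) *F (toℕ c mod p)      ≡⟨ mod-* _ (toℕ c) ⟩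
    ((toℕ a + toℕ b) * toℕ c) mod p               ≡⟨ cong (_mod p) (ℕ.*-distribʳ-+ (toℕ c) (toℕ a) _) ⟩
    (toℕ a * toℕ c + toℕ b * toℕ c) mod p         ≡⟨ mod-+ (toℕ a * toℕ c) _ ⟨
    (a *F c) +F (b *F c)                          ∎
    where open ≡-Reasoning

  +F-identityˡ : ∀ a → 0F +F a ≡ a
  +F-identityˡ a = begin
    0F +F a                    ≡⟨ cong (0F +F_) (toℕ-mod-toℕ a) ⟨
    0F +F (toℕ a mod p)        ≡⟨ mod-+ 0 (toℕ a) ⟩
    toℕ a mod p                ≡⟨ toℕ-mod-toℕ a ⟩
    a                          ∎
    where open ≡-Reasoning

  *F-identityˡ : ∀ a → 1F *F a ≡ a
  *F-identityˡ a = begin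
    1F *F a                    ≡⟨ cong (1F *F_) (toℕ-mod-toℕ a) ⟨
    1F *F (toℕ a mod p)        ≡⟨ mod-* 1 (toℕ a) ⟩
    (1 * toℕ a) mod p          ≡⟨ cong (_mod p) (ℕ.*-identityˡ (toℕ a)) ⟩
    toℕ a mod p                ≡⟨ toℕ-mod-toℕ a ⟩
    a                          ∎
    where open ≡-Reasoning

  -F-inverseˡ : ∀ a → (-F a) +F a ≡ 0F
  -F-inverseˡ a = begin
    (-F a) +F a                      ≡⟨ cong ((-F a) +F_) (toℕ-mod-toℕ a) ⟨
    (-F a) +F (toℕ a mod p)          ≡⟨ mod-+ (p ∸ toℕ a) (toℕ a) ⟩
    (p ∸ toℕ a + toℕ a) mod p        ≡⟨ cong (_mod p) (ℕ.m∸n+n≡m (ℕ.<⇒≤ (toℕ<n a))) ⟩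
    p mod p                          ≡⟨ mod-cong (trans (n%n≡0 p) (sym (m<n⇒m%n≡m (>-nonZero⁻¹ p)))) ⟩
    0F                               ∎
    where open ≡-Reasoning

  F-isCommutativeRing : IsCommutativeRing _≡_ _+F_ _*F_ -F_ 0F 1F
  F-isCommutativeRing = record
    { isRing = record
      { +-isAbelianGroup = record
        { isGroup = record
          { isMonoid = record
            { isSemigroup = record
              { isMagma = record { isEquivalence = isEquivalence ; ∙-cong = cong₂ _+F_ }
              ; assoc = +F-assoc
              }
            ; identity = comm∧idˡ⇒id +F-comm +F-identityˡ
            }
          ; inverse = comm∧invˡ⇒inv +F-comm -F-inverseˡ
          ; ⁻¹-cong = cong (λ a → -F a)
          }
        ; comm = +F-comm
        }
      ; *-cong = cong₂ _*F_
      ; *-assoc = *F-assoc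
      ; *-identity = comm∧idˡ⇒id *F-comm *F-identityˡ
      ; distrib = comm∧distrʳ⇒distrˡ *F-comm *F-distribʳ-+F , *F-distribʳ-+F
      }
    ; *-comm = *F-comm
    }

  F-commutativeRing : CommutativeRing 0ℓ 0ℓ
  F-commutativeRing = record { isCommutativeRing = F-isCommutativeRing }

  private
    module R = CommutativeRing F-commutativeRing
    module R+ = AbelianGroupProperties R.+-abelianGroup
    module R* = RingProperties R.ring
    module RC = CommutativeSemigroupProperties R.+-commutativeSemigroup

  toℕ-mod-< : ∀ {m} → m < p → toℕ (m mod p) ≡ m
  toℕ-mod-< m<p = trans (toℕ-mod _) (m<n⇒m%n≡m m<p)

  mod-≢ : ∀ {m n} → m < p → n < p → m ≢ n → m mod p ≢ n mod p
  mod-≢ m<p n<p m≢n eq = m≢n (trans (sym (toℕ-mod-< m<p)) (trans (cong toℕ eq) (toℕ-mod-< n<p)))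

  mod-multiple : ∀ k → (k * p) mod p ≡ 0F
  mod-multiple k = mod-cong ([m+kn]%n≡m%n 0 k p)

  mod-*F-toℕ : ∀ m (a : F {p}) → (m mod p) *F a ≡ (m * toℕ a) mod p
  mod-*F-toℕ m a = trans (cong ((m mod p) *F_) (sym (toℕ-mod-toℕ a))) (mod-* m (toℕ a))

  module _ (p-prime : Prime p) where

    *F-invertible : ∀ {a : F {p}} → a ≢ 0F → ∃[ b ] b *F a ≡ 1F
    *F-invertible {a} a≢0 with coprime-Bézout (prime⇒coprime p-prime {{≢-nonZero toℕa≢0}} (toℕ<n a))
      where
      toℕa≢0 : toℕ a ≢ 0
      toℕa≢0 eq = a≢0 (trans (sym (toℕ-mod-toℕ a)) (cong (_mod p) eq))
    ... | Bézout.-+ x y 1+xp≡ya = y mod p , (begin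
      (y mod p) *F a        ≡⟨ mod-*F-toℕ y a ⟩
      (y * toℕ a) mod p     ≡⟨ cong (_mod p) 1+xp≡ya ⟨
      (1 + x * p) mod p     ≡⟨ mod-cong ([m+kn]%n≡m%n 1 x p) ⟩
      1F                    ∎)
      where open ≡-Reasoning
    ... | Bézout.+- x y 1+ya≡xp = -F (y mod p) , (begin
      (-F (y mod p)) *F a   ≡⟨ R*.-‿distribˡ-* (y mod p) a ⟨
      -F ((y mod p) *F a)   ≡⟨ cong (λ b → -F b) (R+.inverseʳ-unique 1F _ 1+ya≡0) ⟩
      -F (-F 1F)            ≡⟨ R+.⁻¹-involutive 1F ⟩
      1F                    ∎)
      where
      open ≡-Reasoning
      1+ya≡0 : 1F +F ((y mod p) *F a) ≡ 0F
      1+ya≡0 = begin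
        1F +F ((y mod p) *F a)     ≡⟨ cong (1F +F_) (mod-*F-toℕ y a) ⟩
        1F +F ((y * toℕ a) mod p)  ≡⟨ mod-+ 1 (y * toℕ a) ⟩
        (1 + y * toℕ a) mod p      ≡⟨ cong (_mod p) 1+ya≡xp ⟩
        (x * p) mod p              ≡⟨ mod-multiple x ⟩
        0F                         ∎

    *F-≢0 : ∀ {a b : F {p}} → a ≢ 0F → b ≢ 0F → a *F b ≢ 0F
    *F-≢0 {a} {b} a≢0 b≢0 ab≡0 with *F-invertible a≢0
    ... | a⁻¹ , a⁻¹a≡1 = b≢0 (begin
      b                 ≡⟨ R.*-identityˡ b ⟨
      1F *F b           ≡⟨ cong (_*F b) a⁻¹a≡1 ⟨
      (a⁻¹ *F a) *F b   ≡⟨ R.*-assoc a⁻¹ a b ⟩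
      a⁻¹ *F (a *F b)   ≡⟨ cong (a⁻¹ *F_) ab≡0 ⟩
      a⁻¹ *F 0F         ≡⟨ R.zeroʳ a⁻¹ ⟩
      0F                ∎)
      where open ≡-Reasoning

    1F≢0F : 1F {p} ≢ 0F
    1F≢0F = mod-≢ (nonTrivial⇒n>1 p {{prime⇒nonTrivial p-prime}}) (>-nonZero⁻¹ p) (λ ())

  ∃-≢0-≢ : 2 < p → ∀ (t : F {p}) → ∃[ μ ] μ ≢ 0F × μ ≢ t
  ∃-≢0-≢ 2<p t with t ≟ 1F
  ... | no  t≢1 = 1F , mod-≢ (ℕ.<⇒≤ 2<p) (>-nonZero⁻¹ p) (λ ()) , t≢1 ∘ sym
  ... | yes t≡1 = 2 mod p , mod-≢ 2<p (>-nonZero⁻¹ p) (λ ()) ,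
                  λ 2≡t → mod-≢ 2<p (ℕ.<⇒≤ 2<p) (λ ()) (trans 2≡t t≡1)

  +F-split-≢0 : 2 < p → ∀ t → ∃₂ λ (a b : F {p}) → a ≢ 0F × b ≢ 0F × a +F b ≡ t
  +F-split-≢0 2<p t =
    let μ , μ≢0 , μ≢t = ∃-≢0-≢ 2<p t in
    t -F μ , μ , μ≢t ∘ sym ∘ R+.x∙y⁻¹≈ε⇒x≈y t μ , μ≢0 , R+.//-rightDividesˡ μ t

  -- Vectors over F_p and Horner sums

  infixl 6 _⊕_ _⊖_
  infixr 7 _⊙_

  _⊕_ : ∀ {n} → Vec (F {p}) n → Vec F n → Vec F n
  _⊕_ = zipWith _+F_

  ⊝_ : ∀ {n} → Vec (F {p}) n → Vec F n
  ⊝_ = map (λ a → -F a)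

  0V : ∀ {n} → Vec (F {p}) n
  0V = replicate _ 0F

  _⊖_ : ∀ {n} → Vec (F {p}) n → Vec F n → Vec F n
  v ⊖ w = v ⊕ ⊝ w

  _⊙_ : ∀ {n} → F {p} → Vec F n → Vec F n
  c ⊙ v = map (c *F_) v

  ⊕-isAbelianGroup : ∀ {n} → IsAbelianGroup _≡_ (_⊕_ {n}) 0V ⊝_
  ⊕-isAbelianGroup = record
    { isGroup = record
      { isMonoid = record
        { isSemigroup = record
          { isMagma = record { isEquivalence = isEquivalence ; ∙-cong = cong₂ _⊕_ }
          ; assoc = Vec.zipWith-assoc R.+-assoc
          }
        ; identity = Vec.zipWith-identityˡ R.+-identityˡ , Vec.zipWith-identityʳ R.+-identityʳ
        }
      ; inverse = Vec.zipWith-inverseˡ R.-‿inverseˡ , Vec.zipWith-inverseʳ R.-‿inverseʳ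
      ; ⁻¹-cong = cong ⊝_
      }
    ; comm = Vec.zipWith-comm R.+-comm
    }

  ⊕-abelianGroup : ℕ → AbelianGroup 0ℓ 0ℓ
  ⊕-abelianGroup n = record { isAbelianGroup = ⊕-isAbelianGroup {n} }

  private
    module V {n} = AbelianGroup (⊕-abelianGroup n)
    module V+ {n} = AbelianGroupProperties (⊕-abelianGroup n)
    module VC {n} = CommutativeSemigroupProperties (AbelianGroup.commutativeSemigroup (⊕-abelianGroup n))

  ⊙-0V : ∀ {n} c → c ⊙ 0V {n} ≡ 0V
  ⊙-0V {n} c = trans (Vec.map-replicate (c *F_) 0F n) (cong (replicate n) (R.zeroʳ c))

  Nonvanishing : ∀ {n} → Vec (F {p}) n → Set
  Nonvanishing v = All (_≢ 0F) (toList v)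

  nonvanishing-split : 2 < p → ∀ {n} (v : Vec (F {p}) n) → ∃₂ λ a b → Nonvanishing a × Nonvanishing b × a ⊕ b ≡ v
  nonvanishing-split 2<p []      = [] , [] , [] , [] , refl
  nonvanishing-split 2<p (t ∷ v) =
    let a  , b  , a≢0  , b≢0  , a+b≡t = +F-split-≢0 2<p t
        as , bs , as-nv , bs-nv , as⊕bs≡v = nonvanishing-split 2<p v
    in a ∷ as , b ∷ bs , a≢0 ∷ as-nv , b≢0 ∷ bs-nv , cong₂ _∷_ a+b≡t as⊕bs≡v

  zeroIndicator : F {p} → F {p}
  zeroIndicator x with x ≟ 0F
  ... | yes _ = 1F
  ... | no  _ = 0F

  zeroPattern : ∀ {n} → Vec (F {p}) n → Vec F n
  zeroPattern = map zeroIndicator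

  module _ (p-prime : Prime p) where

    *F-+F-zeroIndicator-≢0 : ∀ {c} → c ≢ 0F → ∀ x → (c *F x) +F zeroIndicator x ≢ 0F
    *F-+F-zeroIndicator-≢0 {c} c≢0 x with x ≟ 0F
    ... | yes refl = λ eq → 1F≢0F p-prime (trans (sym (trans (cong (_+F 1F) (R.zeroʳ c)) (R.+-identityˡ 1F))) eq)
    ... | no  x≢0  = λ eq → *F-≢0 p-prime c≢0 x≢0 (trans (sym (R.+-identityʳ (c *F x))) eq)

    ⊙-⊕-zeroPattern-nonvanishing : ∀ {c} → c ≢ 0F → ∀ {n} (v : Vec F n) → Nonvanishing (c ⊙ v ⊕ zeroPattern v)
    ⊙-⊕-zeroPattern-nonvanishing c≢0 []      = []
    ⊙-⊕-zeroPattern-nonvanishing c≢0 (x ∷ v) = *F-+F-zeroIndicator-≢0 c≢0 x ∷ ⊙-⊕-zeroPattern-nonvanishing c≢0 v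

    zipWith-⊙-⊕-zeroPattern-nonvanishing : ∀ {n m} {μ : Vec F m} → Nonvanishing μ → (Λs : Vec (Vec F n) m) →
      All Nonvanishing (toList (zipWith _⊕_ (zipWith _⊙_ μ Λs) (map zeroPattern Λs)))
    zipWith-⊙-⊕-zeroPattern-nonvanishing {μ = []}    []           []       = []
    zipWith-⊙-⊕-zeroPattern-nonvanishing {μ = _ ∷ _} (c≢0 ∷ μ-nv) (Λ ∷ Λs) =
      ⊙-⊕-zeroPattern-nonvanishing c≢0 Λ ∷ zipWith-⊙-⊕-zeroPattern-nonvanishing μ-nv Λs

  record IsLinear {n} (f : Vec (F {p}) n → Vec F n) : Set where
    field
      ⊕-homo : ∀ v w → f (v ⊕ w) ≡ f v ⊕ f w
      ⊙-homo : ∀ c v → f (c ⊙ v) ≡ c ⊙ f v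

    0V-homo : f 0V ≡ 0V
    0V-homo = V+.identityˡ-unique (f 0V) (f 0V) (trans (sym (⊕-homo 0V 0V)) (cong f (V.identityˡ 0V)))

  ^-isLinear : ∀ {n} {f : Vec (F {p}) n → Vec F n} → IsLinear f → ∀ k → IsLinear (f ^ k)
  ^-isLinear f-linear zero    = record { ⊕-homo = λ _ _ → refl ; ⊙-homo = λ _ _ → refl }
  ^-isLinear {f = f} f-linear (suc k) = record
    { ⊕-homo = λ v w → trans (cong f (⊕-homo v w)) (IsLinear.⊕-homo f-linear _ _)
    ; ⊙-homo = λ c v → trans (cong f (⊙-homo c v)) (IsLinear.⊙-homo f-linear c _)
    }
    where open IsLinear (^-isLinear f-linear k)

  lincomb : ∀ {n m} → Vec (F {p}) m → Vec (Vec F n) m → Vec F n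
  lincomb []      []       = 0V
  lincomb (c ∷ μ) (v ∷ vs) = c ⊙ v ⊕ lincomb μ vs

  basis : ∀ {n} → Vec (Vec (F {p}) n) n
  basis {zero}  = []
  basis {suc n} = (1F ∷ 0V) ∷ map (0F ∷_) basis

  lincomb-map-0F∷ : ∀ {n m} (μ : Vec (F {p}) m) (vs : Vec (Vec F n) m) → lincomb μ (map (0F ∷_) vs) ≡ 0F ∷ lincomb μ vs
  lincomb-map-0F∷ []      []       = refl
  lincomb-map-0F∷ (c ∷ μ) (v ∷ vs) = trans
    (cong (c ⊙ (0F ∷ v) ⊕_) (lincomb-map-0F∷ μ vs))
    (cong (_∷ c ⊙ v ⊕ lincomb μ vs) (trans (R.+-identityʳ (c *F 0F)) (R.zeroʳ c)))

  lincomb-basis : ∀ {n} (μ : Vec (F {p}) n) → lincomb μ basis ≡ μ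
  lincomb-basis []      = refl
  lincomb-basis (c ∷ μ) = begin
    c ⊙ (1F ∷ 0V) ⊕ lincomb μ (map (0F ∷_) basis)  ≡⟨ cong (c ⊙ (1F ∷ 0V) ⊕_) (lincomb-map-0F∷ μ basis) ⟩
    ((c *F 1F) +F 0F) ∷ (c ⊙ 0V ⊕ lincomb μ basis)  ≡⟨ cong₂ _∷_ (trans (R.+-identityʳ _) (R.*-identityʳ c))
                                                                 (cong₂ _⊕_ (⊙-0V c) (lincomb-basis μ)) ⟩
    c ∷ (0V ⊕ μ)                                     ≡⟨ cong (c ∷_) (V.identityˡ μ) ⟩
    c ∷ μ                                            ∎
    where open ≡-Reasoning

  horner : ∀ {n m} → (Vec (F {p}) n → Vec F n) → Vec (Vec F n) m → Vec F n → Vec F n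
  horner T []       a = a
  horner T (v ∷ vs) a = v ⊕ T (horner T vs a)

  module _ {n} {T : Vec (F {p}) n → Vec F n} (T-linear : IsLinear T) where
    open IsLinear T-linear

    horner-⊕ : ∀ {m} (vs ws : Vec (Vec F n) m) a b →
               horner T (zipWith _⊕_ vs ws) (a ⊕ b) ≡ horner T vs a ⊕ horner T ws b
    horner-⊕ []       []       a b = refl
    horner-⊕ (v ∷ vs) (w ∷ ws) a b = begin
      (v ⊕ w) ⊕ T (horner T (zipWith _⊕_ vs ws) (a ⊕ b))  ≡⟨ cong (λ h → (v ⊕ w) ⊕ T h) (horner-⊕ vs ws a b) ⟩
      (v ⊕ w) ⊕ T (horner T vs a ⊕ horner T ws b)        ≡⟨ cong ((v ⊕ w) ⊕_) (⊕-homo _ _) ⟩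
      (v ⊕ w) ⊕ (T (horner T vs a) ⊕ T (horner T ws b))  ≡⟨ VC.interchange v w _ _ ⟩
      (v ⊕ T (horner T vs a)) ⊕ (w ⊕ T (horner T ws b))  ∎
      where open ≡-Reasoning

    module _ {S : Vec F n → Vec F n} (T∘S : ∀ v → T (S v) ≡ v) where

      -- The i-th entry (counting from 1) of  preimages gs  is  Sⁱ gᵢ.
      preimages : ∀ {m} → Vec (Vec F n) m → Vec (Vec F n) m
      preimages []       = []
      preimages (g ∷ gs) = S g ∷ map S (preimages gs)

      T-⊙S-⊕ : ∀ c v w → T (c ⊙ S v ⊕ w) ≡ c ⊙ v ⊕ T w
      T-⊙S-⊕ c v w = trans (⊕-homo _ w) (cong (_⊕ T w) (trans (⊙-homo c (S v)) (cong (c ⊙_) (T∘S v))))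

      T-horner-map-S : ∀ {m} μ (ws : Vec (Vec F n) m) →
                       T (horner T (zipWith _⊙_ μ (map S ws)) 0V) ≡ horner T (zipWith _⊙_ μ ws) 0V
      T-horner-map-S []      []       = 0V-homo
      T-horner-map-S (c ∷ μ) (w ∷ ws) = trans (T-⊙S-⊕ c w _) (cong (λ h → c ⊙ w ⊕ T h) (T-horner-map-S μ ws))

      T-horner-preimages : ∀ {m} μ (gs : Vec (Vec F n) m) →
                           T (horner T (zipWith _⊙_ μ (preimages gs)) 0V) ≡ lincomb μ gs
      T-horner-preimages []      []       = 0V-homo
      T-horner-preimages (c ∷ μ) (g ∷ gs) = begin
        T (c ⊙ S g ⊕ T h)                                       ≡⟨ T-⊙S-⊕ c g (T h) ⟩
        c ⊙ g ⊕ T (T h)                                         ≡⟨ cong (λ x → c ⊙ g ⊕ T x) (T-horner-map-S μ (preimages gs)) ⟩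
        c ⊙ g ⊕ T (horner T (zipWith _⊙_ μ (preimages gs)) 0V)  ≡⟨ cong (c ⊙ g ⊕_) (T-horner-preimages μ gs) ⟩
        c ⊙ g ⊕ lincomb μ gs                                    ∎
        where
        open ≡-Reasoning
        h = horner T (zipWith _⊙_ μ (map S (preimages gs))) 0V

      horner-nonvanishing-surjective : Prime p → 2 < p → ∀ a w →
        ∃ λ (vs : Vec (Vec F n) (suc n)) → All Nonvanishing (toList vs) × horner T vs a ≡ w
      horner-nonvanishing-surjective p-prime 2<p a w =
        let ν , μ , ν-nv , μ-nv , ν⊕μ≡w⊖C = nonvanishing-split 2<p (w ⊖ C)
        in  ν ∷ blocks μ
          , ν-nv ∷ zipWith-⊙-⊕-zeroPattern-nonvanishing p-prime μ-nv Λs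
          , horner-blocks ν μ ν⊕μ≡w⊖C
        where
        Λs = preimages basis
        Zs = map zeroPattern Λs
        C  = T (horner T Zs a)

        blocks : Vec F n → Vec (Vec F n) n
        blocks μ = zipWith _⊕_ (zipWith _⊙_ μ Λs) Zs

        horner-blocks : ∀ ν μ → ν ⊕ μ ≡ w ⊖ C → horner T (ν ∷ blocks μ) a ≡ w
        horner-blocks ν μ ν⊕μ≡w⊖C = begin
          ν ⊕ T (horner T (blocks μ) a)                             ≡⟨ cong (λ b → ν ⊕ T (horner T (blocks μ) b)) (V.identityˡ a) ⟨
          ν ⊕ T (horner T (blocks μ) (0V ⊕ a))                      ≡⟨ cong (λ h → ν ⊕ T h) (horner-⊕ μΛs Zs 0V a) ⟩
          ν ⊕ T (horner T μΛs 0V ⊕ horner T Zs a)                   ≡⟨ cong (ν ⊕_) (⊕-homo _ _) ⟩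
          ν ⊕ (T (horner T μΛs 0V) ⊕ C)                             ≡⟨ cong (λ x → ν ⊕ (x ⊕ C)) (T-horner-preimages μ basis) ⟩
          ν ⊕ (lincomb μ basis ⊕ C)                                 ≡⟨ cong (λ x → ν ⊕ (x ⊕ C)) (lincomb-basis μ) ⟩
          ν ⊕ (μ ⊕ C)                                               ≡⟨ V.assoc ν μ C ⟨
          (ν ⊕ μ) ⊕ C                                               ≡⟨ cong (_⊕ C) ν⊕μ≡w⊖C ⟩
          (w ⊖ C) ⊕ C                                               ≡⟨ V+.//-rightDividesˡ C w ⟩
          w                                                         ∎
          where
          open ≡-Reasoning
          μΛs = zipWith _⊙_ μ Λs

  -- Multiplication and division by x in F_p[x]/(u)

  subScaled : F {p} → F → F → F
  subScaled l s w = s -F (l *F w)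

  subScaled-+F : ∀ l l′ s s′ w → subScaled (l +F l′) (s +F s′) w ≡ subScaled l s w +F subScaled l′ s′ w
  subScaled-+F l l′ s s′ w = begin
    (s +F s′) -F ((l +F l′) *F w)                       ≡⟨ cong (λ x → (s +F s′) -F x) (R.distribʳ w l l′) ⟩
    (s +F s′) -F ((l *F w) +F (l′ *F w))                ≡⟨ cong ((s +F s′) +F_) (R+.⁻¹-∙-comm (l *F w) (l′ *F w)) ⟨
    (s +F s′) +F ((-F (l *F w)) +F (-F (l′ *F w)))      ≡⟨ RC.interchange s s′ _ _ ⟩
    subScaled l s w +F subScaled l′ s′ w                ∎
    where open ≡-Reasoning

  subScaled-*F : ∀ c l s w → subScaled (c *F l) (c *F s) w ≡ c *F subScaled l s w
  subScaled-*F c l s w = begin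
    (c *F s) -F ((c *F l) *F w)   ≡⟨ cong (λ x → (c *F s) -F x) (R.*-assoc c l w) ⟩
    (c *F s) -F (c *F (l *F w))   ≡⟨ R*.x[y-z]≈xy-xz c s (l *F w) ⟨
    c *F (s -F (l *F w))          ∎
    where open ≡-Reasoning

  subScaled-0F : ∀ s w → subScaled 0F s w ≡ s
  subScaled-0F s w = begin
    s -F (0F *F w)   ≡⟨ cong (λ x → s -F x) (R.zeroˡ w) ⟩
    s +F (-F 0F)     ≡⟨ cong (s +F_) R+.ε⁻¹≈ε ⟩
    s +F 0F          ≡⟨ R.+-identityʳ s ⟩
    s                ∎
    where open ≡-Reasoning

  subScaled-addScaled : ∀ l s w → subScaled l (s +F (l *F w)) w ≡ s
  subScaled-addScaled l s w = R+.//-rightDividesʳ (l *F w) s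

  zipWith-subScaled-⊕ : ∀ {n} l l′ (v v′ w : Vec (F {p}) n) →
    zipWith (subScaled (l +F l′)) (v ⊕ v′) w ≡ zipWith (subScaled l) v w ⊕ zipWith (subScaled l′) v′ w
  zipWith-subScaled-⊕ l l′ []      []        []      = refl
  zipWith-subScaled-⊕ l l′ (s ∷ v) (s′ ∷ v′) (x ∷ w) =
    cong₂ _∷_ (subScaled-+F l l′ s s′ x) (zipWith-subScaled-⊕ l l′ v v′ w)

  zipWith-subScaled-⊙ : ∀ {n} c l (v w : Vec (F {p}) n) →
    zipWith (subScaled (c *F l)) (c ⊙ v) w ≡ c ⊙ zipWith (subScaled l) v w
  zipWith-subScaled-⊙ c l []      []      = refl
  zipWith-subScaled-⊙ c l (s ∷ v) (x ∷ w) = cong₂ _∷_ (subScaled-*F c l s x) (zipWith-subScaled-⊙ c l v w)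

  zipWith-subScaled-0F : ∀ {n} (v w : Vec (F {p}) n) → zipWith (subScaled 0F) v w ≡ v
  zipWith-subScaled-0F []      []      = refl
  zipWith-subScaled-0F (s ∷ v) (x ∷ w) = cong₂ _∷_ (subScaled-0F s x) (zipWith-subScaled-0F v w)

  zipWith-subScaled-addScaled : ∀ {n} l (v w : Vec (F {p}) n) →
    zipWith (subScaled l) (zipWith (λ s x → s +F (l *F x)) v w) w ≡ v
  zipWith-subScaled-addScaled l []      []      = refl
  zipWith-subScaled-addScaled l (s ∷ v) (x ∷ w) =
    cong₂ _∷_ (subScaled-addScaled l s x) (zipWith-subScaled-addScaled l v w)

  mulX-⊕ : ∀ {d} (u : Monic d) a b → mulX u (a ⊕ b) ≡ mulX u a ⊕ mulX u b
  mulX-⊕ {zero}  u a b = refl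
  mulX-⊕ {suc d} u a b = begin
    zipWith (subScaled (last (a ⊕ b))) (0F ∷ init (a ⊕ b)) u
      ≡⟨ cong₂ (λ l v → zipWith (subScaled l) (0F ∷ v) u) (last-zipWith _+F_ a b) (init-zipWith _+F_ a b) ⟩
    zipWith (subScaled (last a +F last b)) (0F ∷ (init a ⊕ init b)) u
      ≡⟨ cong (λ x → zipWith (subScaled (last a +F last b)) (x ∷ (init a ⊕ init b)) u) (R.+-identityˡ 0F) ⟨
    zipWith (subScaled (last a +F last b)) ((0F ∷ init a) ⊕ (0F ∷ init b)) u
      ≡⟨ zipWith-subScaled-⊕ (last a) (last b) _ _ u ⟩
    mulX u a ⊕ mulX u b
      ∎
    where open ≡-Reasoning

  mulX-⊙ : ∀ {d} (u : Monic d) c a → mulX u (c ⊙ a) ≡ c ⊙ mulX u a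
  mulX-⊙ {zero}  u c a = refl
  mulX-⊙ {suc d} u c a = begin
    zipWith (subScaled (last (c ⊙ a))) (0F ∷ init (c ⊙ a)) u
      ≡⟨ cong₂ (λ l v → zipWith (subScaled l) (0F ∷ v) u) (last-map (c *F_) a) (init-map (c *F_) a) ⟩
    zipWith (subScaled (c *F last a)) (0F ∷ (c ⊙ init a)) u
      ≡⟨ cong (λ x → zipWith (subScaled (c *F last a)) (x ∷ (c ⊙ init a)) u) (R.zeroʳ c) ⟨
    zipWith (subScaled (c *F last a)) (c ⊙ (0F ∷ init a)) u
      ≡⟨ zipWith-subScaled-⊙ c (last a) _ u ⟩
    c ⊙ mulX u a
      ∎
    where open ≡-Reasoning

  mulX-isLinear : ∀ {d} (u : Monic d) → IsLinear (mulX u)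
  mulX-isLinear u = record { ⊕-homo = mulX-⊕ u ; ⊙-homo = mulX-⊙ u }

  mulX-∷ʳ : ∀ {d} (u : Monic (suc d)) b l → mulX u (b ∷ʳ l) ≡ zipWith (subScaled l) (0F ∷ b) u
  mulX-∷ʳ u b l = cong₂ (λ l′ v → zipWith (subScaled l′) (0F ∷ v) u) (Vec.last-∷ʳ l b) (Vec.init-∷ʳ l b)

  mulX-∷ʳ-0F : ∀ {d} (u : Monic (suc d)) b → mulX u (b ∷ʳ 0F) ≡ 0F ∷ b
  mulX-∷ʳ-0F u b = trans (mulX-∷ʳ u b 0F) (zipWith-subScaled-0F (0F ∷ b) u)

  -- x⁻¹ a = (a - a₀ v₀ u) / x, where a₀ = a(0) and v₀ is the inverse of u(0).
  divX : ∀ {d} → F {p} → Monic d → Quot d → Quot d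
  divX {zero}  v₀ []        []        = []
  divX {suc d} v₀ (u₀ ∷ us) (a₀ ∷ as) = zipWith (λ s x → s +F (l *F x)) as us ∷ʳ l
    where l = -F (a₀ *F v₀)

  mulX-divX : ∀ {d} (u : Monic d) v₀ → v₀ *F const u ≡ 1F → ∀ a → mulX u (divX v₀ u a) ≡ a
  mulX-divX {zero}  []        v₀ v₀u₀≡1 []        = refl
  mulX-divX {suc d} (u₀ ∷ us) v₀ v₀u₀≡1 (a₀ ∷ as) =
    trans (mulX-∷ʳ (u₀ ∷ us) _ l) (cong₂ _∷_ constant-term (zipWith-subScaled-addScaled l as us))
    where
    open ≡-Reasoning
    l = -F (a₀ *F v₀)
    constant-term : subScaled l 0F u₀ ≡ a₀
    constant-term = begin
      0F +F (-F (l *F u₀))             ≡⟨ R.+-identityˡ _ ⟩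
      -F ((-F (a₀ *F v₀)) *F u₀)       ≡⟨ cong (λ x → -F x) (R*.-‿distribˡ-* (a₀ *F v₀) u₀) ⟨
      -F (-F ((a₀ *F v₀) *F u₀))       ≡⟨ R+.⁻¹-involutive _ ⟩
      (a₀ *F v₀) *F u₀                 ≡⟨ R.*-assoc a₀ v₀ u₀ ⟩
      a₀ *F (v₀ *F u₀)                 ≡⟨ cong (a₀ *F_) v₀u₀≡1 ⟩
      a₀ *F 1F                         ≡⟨ R.*-identityʳ a₀ ⟩
      a₀                               ∎

  -- Walks in G_u

  -- foldr (step u) α (c₁ ∷ ⋯ ∷ cₖ) is the end of the walk from α that adds cₖ first and c₁ last.
  step : ∀ {d} → Monic d → F {p} → Quot d → Quot d
  step u c a = addC (mulX u a) c

  addC-⊕ : ∀ {d} (a : Quot {p} d) c → addC a c ≡ a ⊕ addC 0V c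
  addC-⊕ []       c = refl
  addC-⊕ (a ∷ as) c = cong₂ _∷_ (cong (a +F_) (sym (R.+-identityˡ c))) (sym (V.identityʳ as))

  foldr-step-affine : ∀ {d} (u : Monic d) a cs → foldr (step u) a cs ≡ foldr (step u) 0V cs ⊕ (mulX u ^ length cs) a
  foldr-step-affine u a []       = sym (V.identityˡ a)
  foldr-step-affine u a (c ∷ cs) = begin
    addC (mulX u (foldr (step u) a cs)) c    ≡⟨ addC-⊕ _ c ⟩
    mulX u (foldr (step u) a cs) ⊕ e         ≡⟨ cong (λ x → mulX u x ⊕ e) (foldr-step-affine u a cs) ⟩
    mulX u (r ⊕ Xᵏa) ⊕ e                     ≡⟨ cong (_⊕ e) (mulX-⊕ u r Xᵏa) ⟩
    (mulX u r ⊕ mulX u Xᵏa) ⊕ e              ≡⟨ VC.xy∙z≈xz∙y _ _ _ ⟩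
    (mulX u r ⊕ e) ⊕ mulX u Xᵏa              ≡⟨ cong (_⊕ mulX u Xᵏa) (addC-⊕ _ c) ⟨
    step u c r ⊕ mulX u Xᵏa                  ∎
    where
    open ≡-Reasoning
    e   = addC 0V c
    r   = foldr (step u) 0V cs
    Xᵏa = (mulX u ^ length cs) a

  pad : ∀ {n} → List (F {p}) → Vec F n
  pad {zero}  _        = []
  pad {suc n} []       = 0F ∷ pad []
  pad {suc n} (c ∷ cs) = c ∷ pad cs

  pad-[] : ∀ {n} → pad {n} [] ≡ 0V
  pad-[] {zero}  = refl
  pad-[] {suc n} = cong (0F ∷_) pad-[]

  pad-∷ʳ : ∀ {n} (cs : List (F {p})) → length cs ≤ n → pad {suc n} cs ≡ pad {n} cs ∷ʳ 0F
  pad-∷ʳ {zero}  []       _           = refl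
  pad-∷ʳ {suc n} []       _           = cong (0F ∷_) (pad-∷ʳ [] z≤n)
  pad-∷ʳ {suc n} (c ∷ cs) (s≤s len≤n) = cong (c ∷_) (pad-∷ʳ cs len≤n)

  pad-toList : ∀ {n} (v : Vec (F {p}) n) → pad (toList v) ≡ v
  pad-toList []      = refl
  pad-toList (c ∷ v) = cong (c ∷_) (pad-toList v)

  step-pad : ∀ {d} (u : Monic d) c cs → length cs < d → step u c (pad cs) ≡ pad (c ∷ cs)
  step-pad {suc d} u c cs (s≤s len≤d) = begin
    addC (mulX u (pad cs)) c          ≡⟨ cong (λ v → addC (mulX u v) c) (pad-∷ʳ cs len≤d) ⟩
    addC (mulX u (pad cs ∷ʳ 0F)) c    ≡⟨ cong (λ v → addC v c) (mulX-∷ʳ-0F u (pad cs)) ⟩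
    (0F +F c) ∷ pad cs                ≡⟨ cong (_∷ pad cs) (R.+-identityˡ c) ⟩
    c ∷ pad cs                        ∎
    where open ≡-Reasoning

  foldr-step-0V≡pad : ∀ {d} (u : Monic d) cs → length cs ≤ d → foldr (step u) 0V cs ≡ pad cs
  foldr-step-0V≡pad u []       _      = sym pad-[]
  foldr-step-0V≡pad u (c ∷ cs) len<d =
    trans (cong (step u c) (foldr-step-0V≡pad u cs (ℕ.<⇒≤ len<d))) (step-pad u c cs len<d)

  foldr-step-toList-++ : ∀ {d} (u : Monic d) a (v : Quot d) cs →
                         foldr (step u) a (toList v ++ cs) ≡ v ⊕ (mulX u ^ d) (foldr (step u) a cs)
  foldr-step-toList-++ {d} u a v cs = begin
    foldr (step u) a (toList v ++ cs)                            ≡⟨ List.foldr-++ (step u) a (toList v) cs ⟩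
    foldr (step u) r (toList v)                                  ≡⟨ foldr-step-affine u r (toList v) ⟩
    foldr (step u) 0V (toList v) ⊕ (mulX u ^ length (toList v)) r  ≡⟨ cong₂ (λ x k → x ⊕ (mulX u ^ k) r) walk-v len≡d ⟩
    v ⊕ (mulX u ^ d) r                                           ∎
    where
    open ≡-Reasoning
    r = foldr (step u) a cs
    len≡d = Vec.length-toList v
    walk-v : foldr (step u) 0V (toList v) ≡ v
    walk-v = trans (foldr-step-0V≡pad u (toList v) (ℕ.≤-reflexive len≡d)) (pad-toList v)

  foldr-step-concat : ∀ {d m} (u : Monic d) a (vs : Vec (Quot d) m) →
                      foldr (step u) a (toList (concat vs)) ≡ horner (mulX u ^ d) vs a
  foldr-step-concat     u a []       = refl
  foldr-step-concat {d} u a (v ∷ vs) = begin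
    foldr (step u) a (toList (v ++ᵛ concat vs))        ≡⟨ cong (foldr (step u) a) (Vec.toList-++ v (concat vs)) ⟩
    foldr (step u) a (toList v ++ toList (concat vs))  ≡⟨ foldr-step-toList-++ u a v _ ⟩
    v ⊕ T (foldr (step u) a (toList (concat vs)))      ≡⟨ cong (λ x → v ⊕ T x) (foldr-step-concat u a vs) ⟩
    v ⊕ T (horner T vs a)                              ∎
    where
    open ≡-Reasoning
    T = mulX u ^ d

  ∈-nonzeroF : ∀ {c : F {p}} → c ≢ 0F → c ∈ nonzeroF
  ∈-nonzeroF c≢0 = ∈-filter⁺ (λ c → ¬? (c ≟ 0F)) (∈-allFin _) c≢0

  ∈-allQuot : ∀ d (a : Quot {p} d) → a ∈ allQuot d
  ∈-allQuot zero    []       = here refl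
  ∈-allQuot (suc d) (a ∷ as) =
    ∈-concat⁺′ (∈-map⁺ (a ∷_) (∈-allQuot d as)) (∈-map⁺ (λ b → List.map (b ∷_) (allQuot d)) (∈-allFin a))

  M-step-positive : ∀ {d} (u : Monic d) {c} → c ≢ 0F → ∀ a → 0 < M u (step u c a) a
  M-step-positive u {c} c≢0 a =
    0<if (Equivalence.to T-≡ (any⁺ _ (lose (∈-nonzeroF c≢0) (Equivalence.from T-≡ (dec-true (β ≟Q β) refl)))))
    where β = step u c a

  ⊗-positive : ∀ {d} (A B : Mat {p} d) {β γ α} → 0 < A β γ → 0 < B γ α → 0 < (A ⊗ B) β α
  ⊗-positive {d} A B {β} {γ} {α} 0<Aβγ 0<Bγα =
    ℕ.<-≤-trans (ℕ.*-mono-< 0<Aβγ 0<Bγα) (∈⇒≤sum (λ δ → A β δ * B δ α) (∈-allQuot d γ))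

  ^M-foldr-step-positive : ∀ {d} (u : Monic d) α cs → All (_≢ 0F) cs → 0 < (M u ^M length cs) (foldr (step u) α cs) α
  ^M-foldr-step-positive u α []       []           = 0<if (dec-true (α ≟Q α) refl)
  ^M-foldr-step-positive u α (c ∷ cs) (c≢0 ∷ cs≢0) =
    ⊗-positive (M u) (M u ^M length cs) {β = foldr (step u) α (c ∷ cs)}
               (M-step-positive u c≢0 _) (^M-foldr-step-positive u α cs cs≢0)

lemma4p9 : (p : ℕ) {{_ : NonZero p}} → Prime p → ¬ (2 ∣ p) →
           (d : ℕ) (u : Monic {p} d) → ¬ XDivides u →
           (β α : Quot {p} d) → 0 < ((M u ^M (d * d + d)) β α)
lemma4p9 p p-prime p-odd d u u₀≢0 β α =
  let v₀ , v₀u₀≡1 = *F-invertible p-prime u₀≢0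
      T-linear    = ^-isLinear (mulX-isLinear u) d
      T∘S         = ^-inverseʳ (mulX-divX u v₀ v₀u₀≡1) d
      vs , vs-nv , horner≡β = horner-nonvanishing-surjective T-linear T∘S p-prime (odd-prime⇒2<p p-prime p-odd) α β
      cs = toList (concat vs)
  in subst₂ (λ k γ → 0 < (M u ^M k) γ α)
            (trans (Vec.length-toList (concat vs)) (ℕ.+-comm d (d * d)))
            (trans (foldr-step-concat u α vs) horner≡β)
            (^M-foldr-step-positive u α cs (All-toList-concat⁺ vs vs-nv))
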